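{- Let $a\in\hat A$. The image of the homomorphism $k_a:S_{\bar a}\to(\mathbb{Z}/n_a\mathbb{Z})^\times$ contains all elements of $(\mathbb{Z}/n_a\mathbb{Z})^\times$ that are $\equiv 1\pmod{e_a}$; hence it is the preimage of a subgroup of $(\mathbb{Z}/e_a\mathbb{Z})^\times$ under the canonical surjection $(\mathbb{Z}/n_a\mathbb{Z})^\times\to(\mathbb{Z}/e_a\mathbb{Z})^\times$.
   Context: Let $n\ge 3$. Let $\hat{A}=\{(a_1,\dots,a_n)\in(\mathbb{Z}/n\mathbb{Z})^n:\sum a_i=0\}/\{(a,\dots,a)\}$ with classes $[a_1,\dots,a_n]$. $\mathfrak{S}_n$ acts on $\hat A$ by ${}^\sigma[a_1,\dots,a_n]=[a_{\sigma^{ -1}(1)},\dots,a_{\sigma^{ -1}(n)}]$ and $(\mathbb{Z}/n\mathbb{Z})^\times$ acts by $k[a_1,\dots,a_n]=[ka_1,\dots,ka_n]$; these actions commute. For $a=[a_1,\dots,a_n]\in\hat A$: $n_a$ is the order of $a$ in $\hat A$; the subgroup of $\mathbb{Z}/n\mathbb{Z}$ generated by all differences $a_i-a_{i'}$ is $f_a\mathbb{Z}/n\mathbb{Z}$ with $f_a\mid n$, and $n=n_af_a$; the set of $j\in\mathbb{Z}/n\mathbb{Z}$ such that $(a_1+j,\dots,a_n+j)$ is a permutation of $(a_1,\dots,a_n)$ is a subgroup $n'_a\mathbb{Z}/n\mathbb{Z}$ with $n'_a\mid n$, and $n'_a=e_af_a$ for an integer $e_a\mid n_a$. $S_{\bar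 a}$ is the stabilizer in $\mathfrak{S}_n$ of the class $\bar a$ of $a$ modulo $(\mathbb{Z}/n\mathbb{Z})^\times$. For $\sigma\in S_{\bar a}$ there is a unique $k\in(\mathbb{Z}/n_a\mathbb{Z})^\times$ with ${}^\sigma a=ka$; this defines the group homomorphism $k_a:S_{\bar a}\to(\mathbb{Z}/n_a\mathbb{Z})^\times$. -}

module Defs where

open import Data.Nat using (ℕ; zero; suc; _<_; _≤_)
open import Data.Nat.Coprimality using (Coprime)
open import Data.Integer using (ℤ; +_; _+_; _-_; _*_)
open import Data.Integer.Divisibility using (_∣_)
open import Data.Fin using (Fin)
open import Data.Fin.Permutation using (Permutation′; _⟨$⟩ʳ_; _⟨$⟩ˡ_)
open import Data.Product using (Σ; ∃; _×_)
open import Relation.Binary.PropositionalEquality using (_≡_)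

_≡_[mod_] : ℤ → ℤ → ℕ → Set
x ≡ y [mod m ] = (+ m) ∣ (x - y)

sumℤ : ∀ {m} → (Fin m → ℤ) → ℤ
sumℤ {zero}  f = + 0
sumℤ {suc m} f = f Fin.zero + sumℤ {m} (λ i → f (Fin.suc i))
  where import Data.Fin as Fin

-- A tuple (a_1,…,a_n) ∈ (ℤ/nℤ)^n, given by integer representatives.
Tuple : ℕ → Set
Tuple n = Fin n → ℤ

InÂ : (n : ℕ) → Tuple n → Set
InÂ n a = sumℤ a ≡ + 0 [mod n ]

-- Equality of classes in Â = {Σ a_i = 0}/{(c,…,c)}.
_≈Â[_]_ : ∀ {n} → Tuple n → ℕ → Tuple n → Set
_≈Â[_]_ {n} a _ b = Σ ℤ λ c → ∀ i → a i ≡ b i + c [mod n ]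

-- Action of 𝔖_n: (σ·a)_i = a_{σ⁻¹(i)}.
act : ∀ {n} → Permutation′ n → Tuple n → Tuple n
act σ a i = a (σ ⟨$⟩ˡ i)

scale : ∀ {n} → ℤ → Tuple n → Tuple n
scale k a i = k * a i

KillsÂ : ∀ {n} → ℕ → Tuple n → Set
KillsÂ {n} m a = scale (+ m) a ≈Â[ n ] (λ _ → + 0)

IsOrder : ∀ {n} → Tuple n → ℕ → Set
IsOrder a na = (0 < na) × KillsÂ na a × (∀ m → 0 < m → KillsÂ m a → na ≤ m)

ShiftPerm : ∀ {n} → Tuple n → ℕ → Set
ShiftPerm {n} a j = Σ (Permutation′ n) λ τ → ∀ i → (a i + (+ j)) ≡ a (τ ⟨$⟩ʳ i) [mod n ]

-- n'_a: the subgroup of shifts is n'_a ℤ/nℤ with n'_a ∣ n, i.e. n'_a is the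
-- least positive shift (n itself is always a shift).
IsShiftGen : ∀ {n} → Tuple n → ℕ → Set
IsShiftGen a n'a = (0 < n'a) × ShiftPerm a n'a × (∀ j → 0 < j → ShiftPerm a j → n'a ≤ j)

-- σ ∈ S_ā: σ stabilises the class of a modulo (ℤ/nℤ)^×.
InSbar : ∀ {n} → Tuple n → Permutation′ n → Set
InSbar {n} a σ = Σ ℕ λ k → Coprime k n × (act σ a ≈Â[ n ] scale (+ k) a)

-- k_a(σ) = k in (ℤ/n_aℤ)^× : by definition k_a(σ) is the unique class k mod n_a
-- with σa = ka; so "k_a(σ) = k" means σa = ka.
kaIs : ∀ {n} → Tuple n → Permutation′ n → ℤ → Set
kaIs {n} a σ k = act σ a ≈Â[ n ] scale k a

InImage : ∀ {n} → Tuple n → ℤ → Set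
InImage {n} a k = Σ (Permutation′ n) λ σ → InSbar a σ × kaIs a σ k

IsUnitMod : ℤ → ℕ → Set
IsUnitMod k m = Coprime (Data.Integer.∣ k ∣) m
  where import Data.Integer

-- Write n = n_a·f_a and n'_a = e_a·f_a, and let τ be a permutation shifting a by n'_a.
-- As n_a kills a, all entries agree modulo f_a: a_i = a₀ + b_i·f_a. For a unit
-- u = 1 + t·e_a modulo n_a, the map i ↦ τ^(t·b_i mod n_a)(i) moves a_i to
-- a_i + t·b_i·e_a·f_a = u·a_i + (1 - u)·a₀, and it is injective because u is a unit, so it
-- is a permutation σ with σ·a = u·a in Â (Part 1). Part 2 follows from Part 1 and the
-- homomorphism property of k_a, using e_a ∣ n_a, which holds as the least shift n'_a divides n.

module Submission where

open import Defs

open import Data.Fin using (Fin; zero; suc; punchOut; _≟_)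
open import Data.Fin.Permutation as P using (Permutation′; _⟨$⟩ʳ_; _⟨$⟩ˡ_; permutation)
open import Data.Fin.Properties using (any?; punchOut-injective; injective⇒≤)
open import Data.Integer as ℤ using (ℤ; +_; _+_; _-_; _*_; -_; ∣_∣; _%ℕ_; _/ℕ_)
open import Data.Integer.DivMod using (a≡a%ℕn+[a/ℕn]*n; n%ℕd<d)
import Data.Integer.Divisibility.Signed as S
import Data.Integer.Properties as ℤP
open import Data.Integer.Tactic.RingSolver using (solve-∀)
open import Data.Nat as ℕ using (ℕ; zero; suc; _≤_; _<_; z≤n; s≤s; NonZero; _/_; _%_)
open import Data.Nat.Coprimality using (Coprime; coprime-Bézout; gcd≡1⇒coprime; coprime-divisor)
import Data.Nat.Coprimality as Coprime
import Data.Nat.DivMod as ℕDM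
import Data.Nat.Divisibility as ℕD
open import Data.Nat.GCD using (module Bézout; gcd; gcd[m,n]∣m; gcd[m,n]∣n; gcd[m,n]≢0)
open import Data.Nat.Induction using (<-rec)
import Data.Nat.Properties as ℕP
open import Data.Product using (Σ; ∃; _×_; _,_; proj₁; proj₂)
open import Data.Sum using (inj₁; inj₂)
open import Function.Bundles using (Injection)
open import Function.Definitions using (Injective)
open import Function.Properties.Inverse using (↔⇒↣)
open import Level using (0ℓ)
open import Relation.Binary.Bundles using (Setoid)
import Relation.Binary.Reasoning.Setoid
open import Relation.Binary.PropositionalEquality
open import Relation.Nullary using (yes; no; contradiction)

-- The congruence x ≡ y [mod m ] of Defs, wrapped in a record so that x, y and m
-- can be inferred from the type (the bare relation unfolds to a non-injective term).
infix 4 _≋_[mod_]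
record _≋_[mod_] (x y : ℤ) (m : ℕ) : Set where
  constructor ⟨_⟩
  field ≡-mod : x ≡ y [mod m ]
open _≋_[mod_] public

mod-by : ∀ {m x y} q → x ≡ y + q * + m → x ≋ y [mod m ]
mod-by {m} {x} {y} q refl = ⟨ S.∣⇒∣ᵤ (S.divides q (cancel y (q * + m))) ⟩
  where
  cancel : ∀ y z → y + z - y ≡ z
  cancel = solve-∀

mod-witness : ∀ {m x y} → x ≋ y [mod m ] → Σ ℤ λ q → x ≡ y + q * + m
mod-witness {m} {x} {y} ⟨ x≡y ⟩ with S.∣ᵤ⇒∣ {i = x - y} x≡y
... | S.divides q eq = q , (begin
  x                  ≡⟨ restore x y ⟩
  y + (x - y)        ≡⟨ cong (λ z → y + z) eq ⟩
  y + q * + m        ∎)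
  where
  open ≡-Reasoning
  restore : ∀ x y → x ≡ y + (x - y)
  restore = solve-∀

private
  via : ∀ {m x y z} → x - y ≡ z → + m S.∣ z → x ≋ y [mod m ]
  via refl m∣z = ⟨ S.∣⇒∣ᵤ m∣z ⟩

  diff : ∀ {m x y} → x ≋ y [mod m ] → + m S.∣ x - y
  diff {x = x} {y} ⟨ x≡y ⟩ = S.∣ᵤ⇒∣ {i = x - y} x≡y

mod-refl : ∀ {m x} → x ≋ x [mod m ]
mod-refl {m} {x} = mod-by (+ 0) (sym (trans (cong (λ z → x + z) (ℤP.*-zeroˡ (+ m))) (ℤP.+-identityʳ x)))

mod-reflexive : ∀ {m x y} → x ≡ y → x ≋ y [mod m ]
mod-reflexive refl = mod-refl

mod-sym : ∀ {m x y} → x ≋ y [mod m ] → y ≋ x [mod m ]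
mod-sym {x = x} {y} x≡y = via (negate x y) (S.∣m⇒∣-m (diff x≡y))
  where
  negate : ∀ x y → y - x ≡ - (x - y)
  negate = solve-∀

mod-trans : ∀ {m x y z} → x ≋ y [mod m ] → y ≋ z [mod m ] → x ≋ z [mod m ]
mod-trans {x = x} {y} {z} x≡y y≡z = via (split x y z) (S.∣m∣n⇒∣m+n (diff x≡y) (diff y≡z))
  where
  split : ∀ x y z → x - z ≡ (x - y) + (y - z)
  split = solve-∀

mod-setoid : ℕ → Setoid 0ℓ 0ℓ
mod-setoid m = record
  { Carrier = ℤ
  ; _≈_ = λ x y → x ≋ y [mod m ]
  ; isEquivalence = record { refl = mod-refl ; sym = mod-sym ; trans = mod-trans }
  }

module ModReasoning (m : ℕ) = Relation.Binary.Reasoning.Setoid (mod-setoid m)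

mod-+-cong : ∀ {m x y u v} → x ≋ y [mod m ] → u ≋ v [mod m ] → x + u ≋ y + v [mod m ]
mod-+-cong {x = x} {y} {u} {v} x≡y u≡v = via (split x y u v) (S.∣m∣n⇒∣m+n (diff x≡y) (diff u≡v))
  where
  split : ∀ x y u v → (x + u) - (y + v) ≡ (x - y) + (u - v)
  split = solve-∀

mod-*-cong : ∀ {m x y u v} → x ≋ y [mod m ] → u ≋ v [mod m ] → x * u ≋ y * v [mod m ]
mod-*-cong {x = x} {y} {u} {v} x≡y u≡v =
  via (split x y u v) (S.∣m∣n⇒∣m+n (S.∣m⇒∣m*n u (diff x≡y)) (S.∣n⇒∣m*n y (diff u≡v)))
  where
  split : ∀ x y u v → x * u - y * v ≡ (x - y) * u + y * (u - v)
  split = solve-∀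

mod-neg-cong : ∀ {m x y} → x ≋ y [mod m ] → - x ≋ - y [mod m ]
mod-neg-cong {x = x} {y} x≡y = via (negate x y) (S.∣m⇒∣-m (diff x≡y))
  where
  negate : ∀ x y → - x - - y ≡ - (x - y)
  negate = solve-∀

mod-+-congˡ : ∀ {m x y} w → x ≋ y [mod m ] → w + x ≋ w + y [mod m ]
mod-+-congˡ w = mod-+-cong (mod-refl {x = w})

mod-+-congʳ : ∀ {m x y} w → x ≋ y [mod m ] → x + w ≋ y + w [mod m ]
mod-+-congʳ w x≡y = mod-+-cong x≡y (mod-refl {x = w})

mod-*-congˡ : ∀ {m x y} w → x ≋ y [mod m ] → w * x ≋ w * y [mod m ]
mod-*-congˡ w = mod-*-cong (mod-refl {x = w})

mod-*-congʳ : ∀ {m x y} w → x ≋ y [mod m ] → x * w ≋ y * w [mod m ]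
mod-*-congʳ w x≡y = mod-*-cong x≡y (mod-refl {x = w})

mod-+-cancelʳ : ∀ {m x y} w → x + w ≋ y + w [mod m ] → x ≋ y [mod m ]
mod-+-cancelʳ {m} {x} {y} w x+w≡y+w = begin
  x           ≡⟨ restore x w ⟩
  x + w - w   ≈⟨ mod-+-congʳ (- w) x+w≡y+w ⟩
  y + w - w   ≡⟨ restore y w ⟨
  y           ∎
  where
  open ModReasoning m
  restore : ∀ x w → x ≡ x + w - w
  restore = solve-∀

mod-multiple : ∀ {m} q → q * + m ≋ + 0 [mod m ]
mod-multiple {m} q = mod-by q (sym (ℤP.+-identityˡ (q * + m)))

mod-self : ∀ {m} → + m ≋ + 0 [mod m ]
mod-self {m} = subst (λ z → z ≋ + 0 [mod m ]) (ℤP.*-identityˡ (+ m)) (mod-multiple (+ 1))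

mod-divisor : ∀ {d m x y} → d ℕD.∣ m → x ≋ y [mod m ] → x ≋ y [mod d ]
mod-divisor d∣m ⟨ x≡y ⟩ = ⟨ ℕD.∣-trans d∣m x≡y ⟩

mod-scale : ∀ {m x y} c → x ≋ y [mod m ] → x * + c ≋ y * + c [mod m ℕ.* c ]
mod-scale {m} {x} {y} c x≡y with mod-witness x≡y
... | q , refl = mod-by q (begin
  (y + q * + m) * + c      ≡⟨ distribute y q (+ m) (+ c) ⟩
  y * + c + q * (+ m * + c) ≡⟨ cong (λ z → y * + c + q * z) (ℤP.pos-* m c) ⟨
  y * + c + q * + (m ℕ.* c) ∎)
  where
  open ≡-Reasoning
  distribute : ∀ y q m c → (y + q * m) * c ≡ y * c + q * (m * c)
  distribute = solve-∀

mod-cancel : ∀ {m x y} d .{{_ : NonZero d}} → + d * x ≋ + d * y [mod d ℕ.* m ] → x ≋ y [mod m ]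
mod-cancel {m} {x} {y} d dx≡dy with mod-witness dx≡dy
... | q , eq = mod-by q (ℤP.*-cancelˡ-≡ (+ d) x (y + q * + m) (begin
  + d * x                    ≡⟨ eq ⟩
  + d * y + q * + (d ℕ.* m)  ≡⟨ cong (λ z → + d * y + q * z) (ℤP.pos-* d m) ⟩
  + d * y + q * (+ d * + m)  ≡⟨ factor (+ d) y q (+ m) ⟩
  + d * (y + q * + m)        ∎))
  where
  open ≡-Reasoning
  factor : ∀ d y q m → d * y + q * (d * m) ≡ d * (y + q * m)
  factor = solve-∀

%ℕ-mod : ∀ {m} .{{_ : NonZero m}} x → + (x %ℕ m) ≋ x [mod m ]
%ℕ-mod {m} x = mod-sym (mod-by (x /ℕ m) (a≡a%ℕn+[a/ℕn]*n x m))

residue-unique : ∀ {m r s} → r < m → s < m → + r ≋ + s [mod m ] → r ≡ s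
residue-unique {m} {r} {s} r<m s<m ⟨ m∣r-s ⟩ =
  ℤP.+-injective (ℤP.i-j≡0⇒i≡j (+ r) (+ s) (ℤP.∣i∣≡0⇒i≡0 distance≡0))
  where
  distance<m : ∣ + r - + s ∣ < m
  distance<m = ℕP.≤-<-trans (ℕP.≤-reflexive (cong ∣_∣ (ℤP.[+m]-[+n]≡m⊖n r s)))
                 (ℕP.≤-<-trans (ℤP.∣m⊝n∣≤m⊔n r s) (ℕP.⊔-pres-<m r<m s<m))
  below-multiple : ∀ {d} → d < m → m ℕD.∣ d → d ≡ 0
  below-multiple {zero}  _   _   = refl
  below-multiple {suc _} d<m m∣d = contradiction m∣d (ℕD.>⇒∤ d<m)
  distance≡0 : ∣ + r - + s ∣ ≡ 0
  distance≡0 = below-multiple distance<m m∣r-s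

mod⇒%ℕ≡ : ∀ {m x y} .{{_ : NonZero m}} → x ≋ y [mod m ] → x %ℕ m ≡ y %ℕ m
mod⇒%ℕ≡ {m} {x} {y} x≡y = residue-unique (n%ℕd<d x m) (n%ℕd<d y m)
  (mod-trans (%ℕ-mod x) (mod-trans x≡y (mod-sym (%ℕ-mod y))))

embed : ∀ a b c → + (a ℕ.+ b ℕ.* c) ≡ + a + + b * + c
embed a b c = trans (ℤP.pos-+ a (b ℕ.* c)) (cong (λ z → + a + z) (ℤP.pos-* b c))

Invertible : ℤ → ℕ → Set
Invertible u m = Σ ℤ λ v → u * v ≋ + 1 [mod m ]

invertible-cancel : ∀ {m u x y} → Invertible u m → u * x ≋ u * y [mod m ] → x ≋ y [mod m ]
invertible-cancel {m} {u} {x} {y} (v , uv≡1) ux≡uy = begin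
  x               ≡⟨ ℤP.*-identityˡ x ⟨
  + 1 * x         ≈⟨ mod-*-congʳ x uv≡1 ⟨
  u * v * x       ≡⟨ rearrange u v x ⟩
  v * (u * x)     ≈⟨ mod-*-congˡ v ux≡uy ⟩
  v * (u * y)     ≡⟨ rearrange u v y ⟨
  u * v * y       ≈⟨ mod-*-congʳ y uv≡1 ⟩
  + 1 * y         ≡⟨ ℤP.*-identityˡ y ⟩
  y               ∎
  where
  open ModReasoning m
  rearrange : ∀ u v x → u * v * x ≡ v * (u * x)
  rearrange = solve-∀

invertible-* : ∀ {m u w} → Invertible u m → Invertible w m → Invertible (u * w) m
invertible-* {m} {u} {w} (v , uv≡1) (z , wz≡1) = v * z , (begin
  u * w * (v * z)   ≡⟨ rearrange u w v z ⟩
  (u * v) * (w * z) ≈⟨ mod-*-cong uv≡1 wz≡1 ⟩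
  + 1 * + 1         ≡⟨⟩
  + 1               ∎)
  where
  open ModReasoning m
  rearrange : ∀ u w v z → u * w * (v * z) ≡ (u * v) * (w * z)
  rearrange = solve-∀

coprime⇒invertibleℕ : ∀ {m} K → Coprime K m → Invertible (+ K) m
coprime⇒invertibleℕ {m} K K⊥m with coprime-Bézout K⊥m
... | Bézout.+- x y eq = + x , (begin
  + K * + x                ≡⟨ ℤP.*-comm (+ K) (+ x) ⟩
  + x * + K                ≡⟨ ℤP.pos-* x K ⟨
  + (x ℕ.* K)              ≡⟨ cong +_ eq ⟨
  + (1 ℕ.+ y ℕ.* m)        ≡⟨ embed 1 y m ⟩
  + 1 + + y * + m          ≈⟨ mod-+-congˡ (+ 1) (mod-multiple (+ y)) ⟩
  + 1 + + 0                ≡⟨⟩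
  + 1                      ∎)
  where open ModReasoning m
... | Bézout.-+ x y eq = - + x , (begin
  + K * - + x              ≡⟨ complement (+ K) (+ x) ⟩
  + 1 - (+ 1 + + x * + K)  ≡⟨ cong (λ z → + 1 - z) (embed 1 x K) ⟨
  + 1 - + (1 ℕ.+ x ℕ.* K)  ≡⟨ cong (λ z → + 1 - + z) eq ⟩
  + 1 - + (y ℕ.* m)        ≡⟨ cong (λ z → + 1 - z) (ℤP.pos-* y m) ⟩
  + 1 - + y * + m          ≈⟨ mod-+-congˡ (+ 1) (mod-neg-cong (mod-multiple (+ y))) ⟩
  + 1 - + 0                ≡⟨⟩
  + 1                      ∎)
  where
  open ModReasoning m
  complement : ∀ K x → K * - x ≡ + 1 - (+ 1 + x * K)
  complement = solve-∀

coprime⇒invertible : ∀ {m} k → Coprime ∣ k ∣ m → Invertible k m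
coprime⇒invertible {m} k k⊥m with ℤP.+∣i∣≡i⊎+∣i∣≡-i k | coprime⇒invertibleℕ ∣ k ∣ k⊥m
... | inj₁ |k|≡k  | inverse = subst (λ k → Invertible k m) |k|≡k inverse
... | inj₂ |k|≡-k | v , |k|v≡1 = - v , (begin
  k * - v    ≡⟨ flip-sign k v ⟩
  - k * v    ≡⟨ cong (_* v) |k|≡-k ⟨
  + ∣ k ∣ * v ≈⟨ |k|v≡1 ⟩
  + 1        ∎)
  where
  open ModReasoning m
  flip-sign : ∀ k v → k * - v ≡ - k * v
  flip-sign = solve-∀

coprime-divisorʳ : ∀ {d k g} → Coprime d k → g ℕD.∣ k → Coprime d g
coprime-divisorʳ d⊥k g∣k (i∣d , i∣g) = d⊥k (i∣d , ℕD.∣-trans i∣g g∣k)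

-- The part of N coprime to k: some r coprime to k that every divisor of N coprime
-- to k divides. It is obtained by dividing N by gcd(N, k) until the gcd becomes 1.
coprime-part : ∀ k N → .{{NonZero N}} →
               Σ ℕ λ r → Coprime r k × (∀ {d} → d ℕD.∣ N → Coprime d k → d ℕD.∣ r)
coprime-part k N = <-rec P step N
  where
  P : ℕ → Set
  P N = .{{NonZero N}} → Σ ℕ λ r → Coprime r k × (∀ {d} → d ℕD.∣ N → Coprime d k → d ℕD.∣ r)
  step : ∀ N → (∀ {M} → M < N → P M) → P N
  step N rec with gcd N k in g≡ | gcd[m,n]∣m N k | gcd[m,n]∣n N k
  ... | 0 | _ | _ = contradiction g≡ (gcd[m,n]≢0 N k (inj₁ (ℕ.≢-nonZero⁻¹ N)))
  ... | 1 | _ | _ = N , gcd≡1⇒coprime g≡ , λ d∣N _ → d∣N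
  ... | g@(suc (suc _)) | g∣N | g∣k with rec (ℕD.quotient-< g∣N) {{ℕD.quotient≢0 g∣N}}
  ...   | r , r⊥k , maximal = r , r⊥k , λ d∣N d⊥k →
            maximal (coprime-divisor (coprime-divisorʳ d⊥k g∣k)
                                     (subst (_ ℕD.∣_) (ℕD.m∣n⇒n≡m*quotient g∣N) d∣N)) d⊥k

-- A residue k coprime to m can be moved within its class modulo m so as to
-- become coprime to any given N > 0: take k + m·r with r the part of N coprime to k.
lift-coprime : ∀ {k m} N .{{_ : NonZero N}} → Coprime k m → Σ ℕ λ r → Coprime (k ℕ.+ m ℕ.* r) N
lift-coprime {k} {m} N k⊥m with coprime-part k N
... | r , r⊥k , maximal =
  r , λ (i∣k+mr , i∣N) → coprime-to-k i∣k+mr (ℕD.∣-refl , divides-k i∣k+mr i∣N)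
  where
  -- a common divisor of k + m·r and k divides m·r, hence r (being coprime to m), hence is 1
  coprime-to-k : ∀ {i} → i ℕD.∣ k ℕ.+ m ℕ.* r → Coprime i k
  coprime-to-k i∣k+mr (j∣i , j∣k) =
    r⊥k (coprime-divisor (Coprime.sym (coprime-divisorʳ (Coprime.sym k⊥m) j∣k))
                         (ℕD.∣m+n∣m⇒∣n (ℕD.∣-trans j∣i i∣k+mr) j∣k) , j∣k)
  -- a divisor of N coprime to k divides r, so it divides k = (k + m·r) - m·r
  divides-k : ∀ {i} → i ℕD.∣ k ℕ.+ m ℕ.* r → i ℕD.∣ N → i ℕD.∣ k
  divides-k {i} i∣k+mr i∣N = ℕD.∣m+n∣m⇒∣n (subst (i ℕD.∣_) (ℕP.+-comm k (m ℕ.* r)) i∣k+mr)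
                           (ℕD.∣n⇒∣m*n m (maximal i∣N (coprime-to-k i∣k+mr)))

coprime-respects-mod : ∀ {m x y} → x ≋ y [mod m ] → Coprime ∣ x ∣ m → Coprime ∣ y ∣ m
coprime-respects-mod {m} {x} {y} x≡y x⊥m {i} (i∣y , i∣m) = x⊥m (S.∣⇒∣ᵤ i∣x , i∣m)
  where
  i∣x : + i S.∣ x
  i∣x = subst (+ i S.∣_) (shuffle x y)
          (S.∣m∣n⇒∣m+n (S.∣-trans (S.∣ᵤ⇒∣ i∣m) (diff x≡y)) (S.∣ᵤ⇒∣ {i = y} i∣y))
    where
    shuffle : ∀ x y → (x - y) + y ≡ x
    shuffle = solve-∀

lift-unit : ∀ {m} N .{{_ : NonZero m}} .{{_ : NonZero N}} u → Coprime ∣ u ∣ m →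
            Σ ℕ λ k → Coprime k N × + k ≋ u [mod m ]
lift-unit {m} N u u⊥m = r₀ ℕ.+ m ℕ.* r , lifted⊥N , lifted≡u
  where
  r₀ : ℕ
  r₀ = u %ℕ m
  r₀⊥m : Coprime r₀ m
  r₀⊥m = coprime-respects-mod (mod-sym (%ℕ-mod u)) u⊥m
  r : ℕ
  r = proj₁ (lift-coprime N r₀⊥m)
  lifted⊥N : Coprime (r₀ ℕ.+ m ℕ.* r) N
  lifted⊥N = proj₂ (lift-coprime N r₀⊥m)
  lifted≡u : + (r₀ ℕ.+ m ℕ.* r) ≋ u [mod m ]
  lifted≡u = begin
    + (r₀ ℕ.+ m ℕ.* r)     ≡⟨ cong (λ z → + (r₀ ℕ.+ z)) (ℕP.*-comm m r) ⟩
    + (r₀ ℕ.+ r ℕ.* m)     ≡⟨ embed r₀ r m ⟩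
    + r₀ + + r * + m       ≈⟨ mod-+-congˡ (+ r₀) (mod-multiple (+ r)) ⟩
    + r₀ + + 0             ≡⟨ ℤP.+-identityʳ (+ r₀) ⟩
    + r₀                   ≈⟨ %ℕ-mod u ⟩
    u                      ∎
    where open ModReasoning m

-- Pigeonhole: an injective endomap of Fin m is surjective. Otherwise some y is missed
-- and f followed by punching y out would inject Fin (1 + m′) into Fin m′.
injective⇒surjective : ∀ {m} (f : Fin m → Fin m) → Injective _≡_ _≡_ f → ∀ y → ∃ λ x → f x ≡ y
injective⇒surjective {suc m} f f-inj y with any? (λ x → f x ≟ y)
... | yes hit = hit
... | no miss = contradiction (injective⇒≤ {f = squeeze} squeeze-inj) (ℕP.<-irrefl refl)
  where
  avoids : ∀ x → y ≢ f x
  avoids x y≡fx = miss (x , sym y≡fx)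
  squeeze : Fin (suc m) → Fin m
  squeeze x = punchOut (avoids x)
  squeeze-inj : Injective _≡_ _≡_ squeeze
  squeeze-inj eq = f-inj (punchOut-injective (avoids _) (avoids _) eq)

injective⇒permutation : ∀ {m} (f : Fin m → Fin m) → Injective _≡_ _≡_ f →
                        Σ (Permutation′ m) λ P → ∀ i → P ⟨$⟩ˡ i ≡ f i
injective⇒permutation f f-inj =
  permutation preimage f (λ x → f-inj (proj₂ (surj (f x)))) (λ y → proj₂ (surj y)) , λ _ → refl
  where
  surj = injective⇒surjective f f-inj
  preimage = λ y → proj₁ (surj y)

_^_ : ∀ {n} → Permutation′ n → ℕ → Permutation′ n
ρ ^ zero    = P.id
ρ ^ (suc k) = (ρ ^ k) P.∘ₚ ρ

⟨$⟩ʳ-injective : ∀ {n} (ρ : Permutation′ n) → Injective _≡_ _≡_ (ρ ⟨$⟩ʳ_)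
⟨$⟩ʳ-injective ρ = Injection.injective (↔⇒↣ ρ)

record ShiftsBy {N} (a : Tuple N) (s : ℤ) (ρ : Permutation′ N) : Set where
  constructor shifts
  field shift : ∀ i → a i + s ≋ a (ρ ⟨$⟩ʳ i) [mod N ]
open ShiftsBy public

shift-power : ∀ {N} {a : Tuple N} {s ρ} → ShiftsBy a s ρ → ∀ k → ShiftsBy a (+ k * s) (ρ ^ k)
shift-power {N} {a} {s} {ρ} ρ-shift zero = shifts λ i → begin
  a i + + 0 * s  ≡⟨ cong (λ z → a i + z) (ℤP.*-zeroˡ s) ⟩
  a i + + 0      ≡⟨ ℤP.+-identityʳ (a i) ⟩
  a i            ∎
  where open ModReasoning N
shift-power {N} {a} {s} {ρ} ρ-shift (suc k) = shifts λ i → begin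
  a i + + suc k * s         ≡⟨ one-more (a i) (+ k) s ⟩
  (a i + + k * s) + s       ≈⟨ mod-+-congʳ s (shift (shift-power ρ-shift k) i) ⟩
  a ((ρ ^ k) ⟨$⟩ʳ i) + s    ≈⟨ shift ρ-shift ((ρ ^ k) ⟨$⟩ʳ i) ⟩
  a ((ρ ^ suc k) ⟨$⟩ʳ i)    ∎
  where
  open ModReasoning N
  one-more : ∀ x k s → x + (+ 1 + k) * s ≡ (x + k * s) + s
  one-more = solve-∀

shift-inverse : ∀ {N} {a : Tuple N} {s ρ} → ShiftsBy a s ρ → ShiftsBy a (- s) (P.flip ρ)
shift-inverse {N} {a} {s} {ρ} ρ-shift = shifts λ i → let j = ρ ⟨$⟩ˡ i in begin
  a i - s                     ≡⟨ cong (λ j → a j - s) (P.inverseʳ ρ) ⟨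
  a (ρ ⟨$⟩ʳ j) - s            ≈⟨ mod-+-congʳ (- s) (shift ρ-shift j) ⟨
  a j + s - s                 ≡⟨ cancel (a j) s ⟩
  a j                         ∎
  where
  open ModReasoning N
  cancel : ∀ x s → x + s - s ≡ x
  cancel = solve-∀

shift-mod : ∀ {N} {a : Tuple N} {s s′ ρ} → s ≋ s′ [mod N ] → ShiftsBy a s ρ → ShiftsBy a s′ ρ
shift-mod {a = a} s≡s′ ρ-shift = shifts λ i → mod-trans (mod-+-congˡ (a i) (mod-sym s≡s′)) (shift ρ-shift i)

-- The least positive shift s of a divides N: the remainder of N modulo s is again
-- a shift (realised by a power of the inverse of the shift by s), so it must be 0.
shift-generator-∣ : ∀ {N} {a : Tuple N} {s} → IsShiftGen a s → s ℕD.∣ N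
shift-generator-∣ {N} {a} {s} (s>0 , (τ , τ-shift) , minimal) = ℕD.m%n≡0⇒n∣m N s remainder≡0
  where
  instance _ = ℕ.>-nonZero s>0
  q = N / s
  r = N % s
  -qs≡r : + q * - + s ≋ + r [mod N ]
  -qs≡r = begin
    + q * - + s               ≡⟨ complement (+ q) (+ r) (+ s) ⟩
    + r - (+ r + + q * + s)   ≡⟨ cong (λ z → + r - z) (embed r q s) ⟨
    + r - + (r ℕ.+ q ℕ.* s)   ≡⟨ cong (λ z → + r - + z) (ℕDM.m≡m%n+[m/n]*n N s) ⟨
    + r - + N                 ≈⟨ mod-+-congˡ (+ r) (mod-neg-cong mod-self) ⟩
    + r - + 0                 ≡⟨ ℤP.+-identityʳ (+ r) ⟩
    + r                       ∎
    where
    open ModReasoning N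
    complement : ∀ q r s → q * - s ≡ r - (r + q * s)
    complement = solve-∀
  τ-shifts : ShiftsBy a (+ s) τ
  τ-shifts = shifts λ i → ⟨ τ-shift i ⟩
  remainder-shift : ShiftPerm a r
  remainder-shift = P.flip τ ^ q ,
    λ i → ≡-mod (shift (shift-mod -qs≡r (shift-power (shift-inverse τ-shifts) q)) i)
  remainder≡0 : r ≡ 0
  remainder≡0 with r in r≡
  ... | zero  = refl
  ... | suc j = contradiction (minimal (suc j) (s≤s z≤n) (subst (ShiftPerm a) r≡ remainder-shift))
                              (ℕP.<⇒≱ (subst (_< s) r≡ (ℕDM.m%n<n N s)))

-- σ acts on a as multiplication by w, i.e. σ·a = w·a in Â: the relation kaIs of Defs,
-- wrapped in a record so that a, σ and w can be inferred from the type.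
record Realises {N} (a : Tuple N) (σ : Permutation′ N) (w : ℤ) : Set where
  constructor realises
  field acts : kaIs a σ w

realises-mod : ∀ {N m σ w w′} {a : Tuple N} →
               KillsÂ m a → w ≋ w′ [mod m ] → Realises a σ w → Realises a σ w′
realises-mod {N} {m} {σ} {w} {w′} {a} (c₀ , kill) w≡w′ (realises (c , σa≡wa))
  with mod-witness (mod-sym w≡w′)
... | q , refl = realises (c - q * c₀ , λ i → ≡-mod (begin
  a (σ ⟨$⟩ˡ i)                                  ≈⟨ ⟨ σa≡wa i ⟩ ⟩
  w * a i + c                                   ≡⟨ rebalance w q (+ m) (a i) c ⟩
  (w + q * + m) * a i + (c - q * (+ m * a i))   ≈⟨ mod-+-congˡ ((w + q * + m) * a i) (killed i) ⟩
  (w + q * + m) * a i + (c - q * c₀)            ∎))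
  where
  open ModReasoning N
  rebalance : ∀ w q m x c → w * x + c ≡ (w + q * m) * x + (c - q * (m * x))
  rebalance = solve-∀
  killed : ∀ i → c - q * (+ m * a i) ≋ c - q * c₀ [mod N ]
  killed i = mod-+-congˡ c (mod-neg-cong (mod-*-congˡ q
               (mod-trans ⟨ kill i ⟩ (mod-reflexive (ℤP.+-identityˡ c₀)))))

realises-∘ : ∀ {N ρ σ u k} {a : Tuple N} →
             Realises a ρ u → Realises a σ k → Realises a (ρ P.∘ₚ σ) (u * k)
realises-∘ {N} {ρ} {σ} {u} {k} {a} (realises (c₁ , ρa≡ua)) (realises (c₂ , σa≡ka)) =
  realises (u * c₂ + c₁ , λ i → ≡-mod (begin
    a (ρ ⟨$⟩ˡ (σ ⟨$⟩ˡ i))       ≈⟨ ⟨ ρa≡ua (σ ⟨$⟩ˡ i) ⟩ ⟩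
    u * a (σ ⟨$⟩ˡ i) + c₁       ≈⟨ mod-+-congʳ c₁ (mod-*-congˡ u ⟨ σa≡ka i ⟩) ⟩
    u * (k * a i + c₂) + c₁     ≡⟨ expand u k (a i) c₂ c₁ ⟩
    u * k * a i + (u * c₂ + c₁) ∎))
  where
  open ModReasoning N
  expand : ∀ u k x c₂ c₁ → u * (k * x + c₂) + c₁ ≡ u * k * x + (u * c₂ + c₁)
  expand = solve-∀

-- If σ acts on a as multiplication by a unit u modulo a killing modulus m, then σ
-- stabilises ā (via a natural representative of u coprime to N) and k_a(σ) = u.
realises⇒InImage : ∀ {N m σ u} {a : Tuple N} .{{_ : NonZero m}} .{{_ : NonZero N}} →
                   KillsÂ m a → Coprime ∣ u ∣ m → Realises a σ u → InImage a u
realises⇒InImage {N} {m} {σ} {u} {a} kill u⊥m σ≡u =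
  σ , (k , k⊥N , Realises.acts (realises-mod kill (mod-sym k≡u) σ≡u)) , Realises.acts σ≡u
  where
  lifted = lift-unit {m} N u u⊥m
  k = proj₁ lifted
  k⊥N = proj₁ (proj₂ lifted)
  k≡u = proj₂ (proj₂ lifted)

-- Let N = m·f, let every entry of a be congruent to a₀ modulo f,
-- say a_i = a₀ + b_i·f, and let τ shift a by e·f. For u = 1 + t·e invertible modulo m,
-- the map π : i ↦ τ^(t·b_i mod m)(i) sends a_i to u·a_i + (1 - u)·a₀ (mod N); it is
-- injective, hence a permutation σ acting on a as multiplication by u.
module AffinePermutation
  {N m f e : ℕ} .{{_ : NonZero m}} .{{_ : NonZero f}} (N≡m*f : N ≡ m ℕ.* f)
  {a : Tuple N} {a₀ : ℤ} (a≡a₀ : ∀ i → a i ≋ a₀ [mod f ])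
  {τ : Permutation′ N} (τ-shift : ShiftsBy a (+ e * + f) τ)
  (t : ℤ) (u-inv : Invertible (+ 1 + t * + e) m)
  where

  u : ℤ
  u = + 1 + t * + e

  b : Fin N → ℤ
  b i = proj₁ (mod-witness (a≡a₀ i))

  b-spec : ∀ i → a i ≡ a₀ + b i * + f
  b-spec i = proj₂ (mod-witness (a≡a₀ i))

  exponent : Fin N → ℕ
  exponent i = (t * b i) %ℕ m

  π : Fin N → Fin N
  π i = (τ ^ exponent i) ⟨$⟩ʳ i

  -- τ^k shifts by k·e·f, and k ≡ t·b_i (mod m) makes this t·e·(a_i - a₀) = (u - 1)(a_i - a₀).
  π-value : ∀ i → a (π i) ≋ u * a i + (+ 1 - u) * a₀ [mod N ]
  π-value i = begin
    a (π i)                              ≈⟨ shift (shift-power τ-shift (exponent i)) i ⟨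
    a i + + exponent i * (+ e * + f)     ≈⟨ mod-+-congˡ (a i) exponent-scaled ⟩
    a i + t * b i * (+ e * + f)          ≡⟨ affine (a i) (b-spec i) ⟩
    u * a i + (+ 1 - u) * a₀             ∎
    where
    open ModReasoning N
    N∣m*ef : N ℕD.∣ m ℕ.* (e ℕ.* f)
    N∣m*ef = subst (ℕD._∣ m ℕ.* (e ℕ.* f)) (sym N≡m*f) (ℕD.*-monoʳ-∣ m (ℕD.n∣m*n e))
    exponent-scaled : + exponent i * (+ e * + f) ≋ t * b i * (+ e * + f) [mod N ]
    exponent-scaled = begin
      + exponent i * (+ e * + f)   ≡⟨ cong (+ exponent i *_) (ℤP.pos-* e f) ⟨
      + exponent i * + (e ℕ.* f)   ≈⟨ mod-divisor N∣m*ef (mod-scale (e ℕ.* f) (%ℕ-mod (t * b i))) ⟩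
      t * b i * + (e ℕ.* f)        ≡⟨ cong (t * b i *_) (ℤP.pos-* e f) ⟩
      t * b i * (+ e * + f)        ∎
    affine : ∀ x → x ≡ a₀ + b i * + f → x + t * b i * (+ e * + f) ≡ u * x + (+ 1 - u) * a₀
    affine _ refl = identity a₀ (b i) t (+ e) (+ f)
      where
      identity : ∀ a₀ b t e f → (a₀ + b * f) + t * b * (e * f) ≡
                 (+ 1 + t * e) * (a₀ + b * f) + (+ 1 - (+ 1 + t * e)) * a₀
      identity = solve-∀

  -- If π i = π j then u·a_i ≡ u·a_j (mod N), so u·b_i ≡ u·b_j (mod m), so b_i ≡ b_j (mod m)
  -- as u is a unit: both use the same power of τ, which is injective.
  π-injective : Injective _≡_ _≡_ π
  π-injective {i} {j} πi≡πj =
    ⟨$⟩ʳ-injective (τ ^ exponent j) (subst (λ k → (τ ^ k) ⟨$⟩ʳ i ≡ π j) same-exponent πi≡πj)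
    where
    ua≡ua : u * a i ≋ u * a j [mod N ]
    ua≡ua = mod-+-cancelʳ ((+ 1 - u) * a₀)
      (mod-trans (mod-sym (π-value i)) (mod-trans (mod-reflexive (cong a πi≡πj)) (π-value j)))
    spread : ∀ k → u * a k ≡ + f * (u * b k) + u * a₀
    spread k = trans (cong (u *_) (b-spec k)) (rearrange u a₀ (b k) (+ f))
      where
      rearrange : ∀ u a₀ b f → u * (a₀ + b * f) ≡ f * (u * b) + u * a₀
      rearrange = solve-∀
    fub≡fub : + f * (u * b i) ≋ + f * (u * b j) [mod f ℕ.* m ]
    fub≡fub = subst (λ M → + f * (u * b i) ≋ + f * (u * b j) [mod M ]) (trans N≡m*f (ℕP.*-comm m f))
      (mod-+-cancelʳ (u * a₀) (subst₂ (λ x y → x ≋ y [mod N ]) (spread i) (spread j) ua≡ua))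
    same-exponent : exponent i ≡ exponent j
    same-exponent = mod⇒%ℕ≡ (mod-*-congˡ t (invertible-cancel {u = u} u-inv (mod-cancel f fub≡fub)))

  affine-permutation : Σ (Permutation′ N) λ σ → Realises a σ u
  affine-permutation = proj₁ σ , realises ((+ 1 - u) * a₀ , λ i →
    subst (λ k → a k ≡ u * a i + (+ 1 - u) * a₀ [mod N ]) (sym (proj₂ σ i)) (≡-mod (π-value i)))
    where
    σ = injective⇒permutation π π-injective

affine-realisation : ∀ {N m f e} .{{_ : NonZero m}} .{{_ : NonZero f}} → N ≡ m ℕ.* f →
  ∀ {a : Tuple N} {a₀} → (∀ i → a i ≋ a₀ [mod f ]) →
  ∀ {τ} → ShiftsBy a (+ e * + f) τ →
  ∀ {u} → u ≋ + 1 [mod e ] → Invertible u m → Σ (Permutation′ N) λ σ → Realises a σ u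
affine-realisation {N} {m} N≡m*f {a} a≡a₀ τ-shift {u} u≡1 u-inv =
  subst (λ u → Σ (Permutation′ N) λ σ → Realises a σ u) (sym u≡1+te)
        (AffinePermutation.affine-permutation N≡m*f a≡a₀ τ-shift t
          (subst (λ u → Invertible u m) u≡1+te u-inv))
  where
  t = proj₁ (mod-witness u≡1)
  u≡1+te = proj₂ (mod-witness u≡1)

killed⇒entries-congruent : ∀ {N m f} {a : Tuple N} .{{_ : NonZero m}} → N ≡ m ℕ.* f →
                           KillsÂ m a → ∀ i j → a i ≋ a j [mod f ]
killed⇒entries-congruent {N} {m} {f} {a} N≡m*f (c₀ , kill) i j =
  mod-cancel m (subst (λ M → + m * a i ≋ + m * a j [mod M ]) N≡m*f
                      (mod-trans ⟨ kill i ⟩ (mod-sym ⟨ kill j ⟩)))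

-- Indeed, if
-- σ realises k and k′ ≡ k (mod e), let x = k⁻¹ mod m: the unit x·k′ is ≡ 1 (mod e), so some
-- ρ realises it, and ρ∘σ realises x·k′·k ≡ k′ (mod m).
image-saturated : ∀ {N m e} {a : Tuple N} .{{_ : NonZero m}} .{{_ : NonZero N}} →
  KillsÂ m a → e ℕD.∣ m →
  (∀ {u} → u ≋ + 1 [mod e ] → Invertible u m → Σ (Permutation′ N) λ σ → Realises a σ u) →
  ∀ {k k′} → Coprime ∣ k ∣ m → Coprime ∣ k′ ∣ m → k ≋ k′ [mod e ] → InImage a k → InImage a k′
image-saturated {m = m} {e} {a} kill e∣m realise {k} {k′} k⊥m k′⊥m k≡k′ (σ , _ , σ≡k) =
  realises⇒InImage {m = m} kill k′⊥m (realises-mod kill xk′k≡k′ ρσ-realises)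
  where
  x = proj₁ (coprime⇒invertible k k⊥m)
  xk≡1 : x * k ≋ + 1 [mod m ]
  xk≡1 = subst (λ z → z ≋ + 1 [mod m ]) (ℤP.*-comm k x) (proj₂ (coprime⇒invertible k k⊥m))
  xk′≡1 : x * k′ ≋ + 1 [mod e ]
  xk′≡1 = mod-trans (mod-*-congˡ x (mod-sym k≡k′)) (mod-divisor e∣m xk≡1)
  ρ = realise xk′≡1 (invertible-* {u = x} (k , xk≡1) (coprime⇒invertible k′ k′⊥m))
  ρσ-realises : Realises a (proj₁ ρ P.∘ₚ σ) (x * k′ * k)
  ρσ-realises = realises-∘ (proj₂ ρ) (realises {σ = σ} {w = k} σ≡k)
  xk′k≡k′ : x * k′ * k ≋ k′ [mod m ]
  xk′k≡k′ = begin
    x * k′ * k     ≡⟨ rearrange x k′ k ⟩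
    x * k * k′     ≈⟨ mod-*-congʳ k′ xk≡1 ⟩
    + 1 * k′       ≡⟨ ℤP.*-identityˡ k′ ⟩
    k′             ∎
    where
    open ModReasoning m
    rearrange : ∀ x k′ k → x * k′ * k ≡ x * k * k′
    rearrange = solve-∀

theorem5p5 : (n : ℕ) → 3 ≤ n → (a : Tuple n) → InÂ n a →
    (na fa n'a ea : ℕ) → IsOrder a na → n ≡ na ℕ.* fa → IsShiftGen a n'a → n'a ≡ ea ℕ.* fa →
    ((k : ℤ) → IsUnitMod k na → k ≡ + 1 [mod ea ] → InImage a k)
    × ((k k′ : ℤ) → IsUnitMod k na → IsUnitMod k′ na → k ≡ k′ [mod ea ] →
        InImage a k → InImage a k′)
theorem5p5 n@(suc _) _ a _ na fa n'a ea (na>0 , kill , _) n≡na*fa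
           shift-gen@(_ , (τ , τ-shift) , _) n'a≡ea*fa =
  (λ k k⊥na k≡1 → realises⇒InImage {m = na} kill k⊥na
                    (proj₂ (realise {k} ⟨ k≡1 ⟩ (coprime⇒invertible k k⊥na)))) ,
  (λ k k′ k⊥na k′⊥na k≡k′ → image-saturated kill ea∣na realise {k} {k′} k⊥na k′⊥na ⟨ k≡k′ ⟩)
  where
  instance
    na≢0 : NonZero na
    na≢0 = ℕ.>-nonZero na>0
    fa≢0 : NonZero fa
    fa≢0 = ℕP.m*n≢0⇒n≢0 na {{subst NonZero n≡na*fa _}}
  a≡a₀ : ∀ i → a i ≋ a zero [mod fa ]
  a≡a₀ i = killed⇒entries-congruent {a = a} n≡na*fa kill i zero
  τ-shifts : ShiftsBy a (+ ea * + fa) τ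
  τ-shifts = shifts λ i → subst (λ s → a i + s ≋ a (τ ⟨$⟩ʳ i) [mod n ])
                                (trans (cong +_ n'a≡ea*fa) (ℤP.pos-* ea fa)) ⟨ τ-shift i ⟩
  ea∣na : ea ℕD.∣ na
  ea∣na = ℕD.*-cancelʳ-∣ fa (subst₂ ℕD._∣_ n'a≡ea*fa n≡na*fa (shift-generator-∣ {a = a} shift-gen))
  realise : ∀ {u} → u ≋ + 1 [mod ea ] → Invertible u na → Σ (Permutation′ n) λ σ → Realises a σ u
  realise = affine-realisation n≡na*fa a≡a₀ τ-shifts
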